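{- Let $(\mathbf A;G,H)$ be a dynamic De Morgan algebra (see context) and let $$R_G=\{(s,t)\in T_{\mathbf A}^{\mathrm{DMP}}\times T_{\mathbf A}^{\mathrm{DMP}}\mid \forall x\in A:\ s(G(x))\leq t(x)\}.$$ Then $(T_{\mathbf A}^{\mathrm{DMP}},R_G)$ is a frame with both $R_G$ and $(R_G)^{ -1}$ serial, and $(\mathbf A;G,H)$ can be embedded into $(\mathbf{M}_2^{T_{\mathbf A}^{\mathrm{DMP}}};\widehat G,\widehat H)$, where $\widehat G(p)(s)=\bigwedge_{M_2}\{p(t)\mid s\mathrel{R_G}t\}$ and $\widehat H(p)(s)=\bigwedge_{M_2}\{p(t)\mid t\mathrel{R_G}s\}$; namely, the map $i_{\mathbf A}(a)(s)=s(a)$ is an order-reflecting morphism of De Morgan posets $A\to M_2^{T_{\mathbf A}^{\mathrm{DMP}}}$ with $i_{\mathbf A}(G(a))=\widehat G(i_{\mathbf A}(a))$ and $i_{\mathbf A}(H(a))=\widehat H(i_{\mathbf A}(a))$ for all $a\in A$.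
   Context: A De Morgan poset is a structure $(A;\leq,{}',0,1)$ where $(A;\leq)$ is a poset with least element $0$ and greatest element $1$, and $'$ is a unary operation with $a\leq b\Rightarrow b'\leq a'$ and $a''=a$. A morphism of De Morgan posets preserves order, negation, $0$, $1$; it is order reflecting if $f(a)\leq f(b)$ iff $a\leq b$. A dynamic De Morgan algebra is a triple $(\mathbf A;G,H)$ with $\mathbf A$ a De Morgan poset and $G,H\colon A\to A$ total maps such that, with $F(x)=G(x')'$ and $P(x)=H(x')'$: (P1) $G(0)=0$, $G(1)=1$, $H(0)=0$, $H(1)=1$; (P2) $x\leq y$ implies $G(x)\leq G(y)$ and $H(x)\leq H(y)$; (P3) $x\leq G(P(x))$ and $x\leq H(F(x))$; (P4) $x\leq y$ implies $G(x)\leq F(y)$ and $H(x)\leq P(y)$. A frame is a pair $(T,R)$ with $T$ non-empty and $R\subseteq T\times T$; $R$ is serial if every $x$ has some $y$ with $x\mathrel{R}y$. $\mathbf{M}_2$ is the four-element complete De Morgan lattice on $\{0,1\}\times\{0,1\}$ with componentwise order and $(a,b)'=(1-b,1-a)$; $\mathbf{M}_2^T$ is the direct power with componentwise order and negation. For a proper down-set $D$ of $\mathbf A$ (down-set with $0\in D$, $1\notin D$) let $h_D(a)=0$ iff $a\in D$ (else $1$), $h_D^{\partial}(a)=1-h_D(a')$, and $\kappa_D(a)=(h_D(a),h_D^{\partial}(a))\in M_2$. $T_{\mathbf A}^{\mathrm{DMP}}$ is the set of all $\kappa_D$, $D$ ranging over proper down-sets of $\mathbf A$. -}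

module Defs where

open import Level using (Level; _⊔_) renaming (suc to lsuc)
open import Data.Bool.Base using (Bool; true; false; not) renaming (_≤_ to _≤B_)
open import Data.Product using (Σ; ∃; _×_; _,_; proj₁; proj₂)
open import Relation.Binary.Core using (Rel)
open import Relation.Binary.Structures using (IsPartialOrder)
open import Relation.Binary.PropositionalEquality using (_≡_)

record DeMorganPoset (a ℓ : Level) : Set (lsuc (a ⊔ ℓ)) where
  infix 4 _≤_
  field
    Carrier        : Set a
    _≤_            : Rel Carrier ℓ
    isPartialOrder : IsPartialOrder _≡_ _≤_
    𝟎 𝟏            : Carrier
    𝟎-least        : ∀ x → 𝟎 ≤ x
    𝟏-greatest     : ∀ x → x ≤ 𝟏
    _′             : Carrier → Carrier
    ′-antitone     : ∀ {x y} → x ≤ y → (y ′) ≤ (x ′)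
    ′-involutive   : ∀ x → ((x ′) ′) ≡ x

record DynamicDMA (a ℓ : Level) : Set (lsuc (a ⊔ ℓ)) where
  field
    poset : DeMorganPoset a ℓ
  open DeMorganPoset poset public
  field
    G H : Carrier → Carrier
  F : Carrier → Carrier
  F x = (G (x ′)) ′
  P : Carrier → Carrier
  P x = (H (x ′)) ′
  field
    G-𝟎 : G 𝟎 ≡ 𝟎
    G-𝟏 : G 𝟏 ≡ 𝟏
    H-𝟎 : H 𝟎 ≡ 𝟎
    H-𝟏 : H 𝟏 ≡ 𝟏
    G-mono : ∀ {x y} → x ≤ y → G x ≤ G y
    H-mono : ∀ {x y} → x ≤ y → H x ≤ H y
    P3-G : ∀ x → x ≤ G (P x)
    P3-H : ∀ x → x ≤ H (F x)
    P4-G : ∀ {x y} → x ≤ y → G x ≤ F y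
    P4-H : ∀ {x y} → x ≤ y → H x ≤ P y

-- The four-element De Morgan lattice M₂ on {0,1}×{0,1}
-- (false = 0, true = 1)

M₂ : Set
M₂ = Bool × Bool

infix 4 _≤M_
_≤M_ : M₂ → M₂ → Set
(a , b) ≤M (c , d) = (a ≤B c) × (b ≤B d)

_′M : M₂ → M₂
(a , b) ′M = (not b , not a)

0M 1M : M₂
0M = (false , false)
1M = (true , true)

IsMeetM₂ : ∀ {s} → (M₂ → Set s) → M₂ → Set s
IsMeetM₂ S m =
  (∀ x → S x → m ≤M x) × (∀ y → (∀ x → S x → y ≤M x) → y ≤M m)

Serial : ∀ {t r} {T : Set t} → Rel T r → Set (t ⊔ r)
Serial {T = T} R = ∀ x → ∃ λ y → R x y

-- (T , R) is a frame: T non-empty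
IsFrame : ∀ {t r} (T : Set t) → Rel T r → Set t
IsFrame T R = T

module _ {a ℓ} (𝐀 : DeMorganPoset a ℓ) where
  open DeMorganPoset 𝐀

  record ProperDownSet : Set (a ⊔ ℓ) where
    field
      inD     : Carrier → Bool
      down    : ∀ {x y} → x ≤ y → inD y ≡ true → inD x ≡ true
      𝟎∈D     : inD 𝟎 ≡ true
      𝟏∉D     : inD 𝟏 ≡ false

  h : ProperDownSet → Carrier → Bool
  h D x = not (ProperDownSet.inD D x)

  h∂ : ProperDownSet → Carrier → Bool
  h∂ D x = not (h D (x ′))

  κ : ProperDownSet → Carrier → M₂
  κ D x = (h D x , h∂ D x)

  record TDMP : Set (a ⊔ ℓ) where
    constructor point
    field
      fun  : Carrier → M₂
      isκ  : ∃ λ (D : ProperDownSet) → ∀ x → fun x ≡ κ D x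

module _ {a ℓ} (𝔸 : DynamicDMA a ℓ) where
  open DynamicDMA 𝔸

  T : Set (a ⊔ ℓ)
  T = TDMP poset

  _⟨_⟩ : T → Carrier → M₂
  s ⟨ x ⟩ = TDMP.fun s x

  RG : Rel T a
  RG s t = ∀ x → s ⟨ G x ⟩ ≤M t ⟨ x ⟩

  RG⁻¹ : Rel T a
  RG⁻¹ s t = RG t s

  i : Carrier → (T → M₂)
  i x s = s ⟨ x ⟩

  _≤ᵀ_ : (T → M₂) → (T → M₂) → Set (a ⊔ ℓ)
  p ≤ᵀ q = ∀ s → p s ≤M q s

  _′ᵀ : (T → M₂) → (T → M₂)
  (p ′ᵀ) s = (p s) ′M

  _≗ᵀ_ : (T → M₂) → (T → M₂) → Set (a ⊔ ℓ)
  p ≗ᵀ q = ∀ s → p s ≡ q s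

  IsĜ : (T → M₂) → (T → M₂) → Set (a ⊔ ℓ)
  IsĜ p q = ∀ s → IsMeetM₂ (λ m → ∃ λ t → RG s t × p t ≡ m) (q s)

  IsĤ : (T → M₂) → (T → M₂) → Set (a ⊔ ℓ)
  IsĤ p q = ∀ s → IsMeetM₂ (λ m → ∃ λ t → RG t s × p t ≡ m) (q s)

  IsOrderReflectingDMPMorphism : Set (a ⊔ ℓ)
  IsOrderReflectingDMPMorphism =
      (∀ {x y} → x ≤ y → i x ≤ᵀ i y)
    × (∀ {x y} → i x ≤ᵀ i y → x ≤ y)
    × (∀ x → i (x ′) ≗ᵀ ((i x) ′ᵀ))
    × (∀ s → i 𝟎 s ≡ 0M)
    × (∀ s → i 𝟏 s ≡ 1M)

-- Every point of the canonical frame is κ_D for a proper down-set D, and the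
-- relation R_G between points is governed by preimages of down-sets: G⁻¹[D] and
-- F⁻¹[D] are R_G-successors of κ_D, H⁻¹[D] and P⁻¹[D] are R_G-predecessors.  The
-- meet defining Ĝ(i a)(κ_D) is bounded below by κ_D(G a) by the definition of R_G,
-- and it is attained coordinatewise, the first coordinate at G⁻¹[D] and the second at
-- F⁻¹[D].  For Ĥ the lower bound is the adjunction between G and H expressed by
-- (P3), and the meet is attained at H⁻¹[D] and P⁻¹[D].  Order reflection separates
-- a ≰ b by the principal down-set ↓b, which exists by excluded middle.
module Submission where

open import Defs
open import Level using (_⊔_; lift; lower)
open import Data.Bool.Base using (Bool; true; false; not; b≤b; f≤t) renaming (_≤_ to _≤B_)
open import Data.Bool.Properties using (not-involutive)
open import Data.Product using (_×_; _,_; proj₁; proj₂)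
open import Function using (id)
open import Relation.Binary.Core using (Rel)
open import Relation.Binary.Structures using (IsPartialOrder)
open import Relation.Binary.PropositionalEquality
  using (_≡_; _≢_; refl; sym; trans; cong; cong₂; subst; subst₂; module ≡-Reasoning)
open import Relation.Nullary using (Dec; yes; no; does; ¬_; contradiction)
open import Relation.Nullary.Decidable using (map′; dec-true; dec-false)
open import Axiom.ExcludedMiddle using (ExcludedMiddle)

≤B-intro : ∀ {p q : Bool} → (p ≡ true → q ≡ true) → p ≤B q
≤B-intro {false} {false} _ = b≤b
≤B-intro {false} {true}  _ = f≤t
≤B-intro {true}  {false} p⇒q with () ← p⇒q refl
≤B-intro {true}  {true}  _ = b≤b

≤B-elim : ∀ {p q : Bool} → p ≤B q → p ≡ true → q ≡ true
≤B-elim b≤b p≡true = p≡true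
≤B-elim f≤t _      = refl

not-antitone : ∀ {p q : Bool} → q ≤B p → not p ≤B not q
not-antitone b≤b = b≤b
not-antitone f≤t = f≤t

not-reflects : ∀ {p q : Bool} → not p ≤B not q → q ≤B p
not-reflects {true}  {true}  _ = b≤b
not-reflects {true}  {false} _ = f≤t
not-reflects {false} {false} _ = b≤b

coordinatewise-attained⇒IsMeetM₂ : ∀ {s} {S : M₂ → Set s} {m u v} →
  (∀ x → S x → m ≤M x) → S u → S v → m ≡ (proj₁ u , proj₂ v) → IsMeetM₂ S m
coordinatewise-attained⇒IsMeetM₂ lowerBound u∈S v∈S refl =
  lowerBound , λ y y≤S → proj₁ (y≤S _ u∈S) , proj₂ (y≤S _ v∈S)

module DeMorganPosetProperties {a ℓ} (𝐀 : DeMorganPoset a ℓ) where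
  open DeMorganPoset 𝐀
  open IsPartialOrder isPartialOrder using (antisym) renaming (refl to ≤-refl; trans to ≤-trans)
  open ProperDownSet

  ′-𝟎 : 𝟎 ′ ≡ 𝟏
  ′-𝟎 = antisym (𝟏-greatest _) (subst (_≤ 𝟎 ′) (′-involutive 𝟏) (′-antitone (𝟎-least (𝟏 ′))))

  ′-𝟏 : 𝟏 ′ ≡ 𝟎
  ′-𝟏 = trans (cong _′ (sym ′-𝟎)) (′-involutive 𝟎)

  dual-mono : ∀ (f : Carrier → Carrier) → (∀ {x y} → x ≤ y → f x ≤ f y) → ∀ {x y} → x ≤ y → f (x ′) ′ ≤ f (y ′) ′
  dual-mono _ f-mono x≤y = ′-antitone (f-mono (′-antitone x≤y))

  dual-𝟎 : ∀ (f : Carrier → Carrier) → f 𝟏 ≡ 𝟏 → f (𝟎 ′) ′ ≡ 𝟎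
  dual-𝟎 f f-𝟏 = trans (cong (λ x → f x ′) ′-𝟎) (trans (cong _′ f-𝟏) ′-𝟏)

  dual-𝟏 : ∀ (f : Carrier → Carrier) → f 𝟎 ≡ 𝟎 → f (𝟏 ′) ′ ≡ 𝟏
  dual-𝟏 f f-𝟎 = trans (cong (λ x → f x ′) ′-𝟏) (trans (cong _′ f-𝟎) ′-𝟎)

  infix 4 _∈_
  _∈_ : Carrier → ProperDownSet 𝐀 → Set
  x ∈ D = inD D x ≡ true

  preimage : (f : Carrier → Carrier) → (∀ {x y} → x ≤ y → f x ≤ f y) → f 𝟎 ≡ 𝟎 → f 𝟏 ≡ 𝟏 →
             ProperDownSet 𝐀 → ProperDownSet 𝐀
  preimage f f-mono f-𝟎 f-𝟏 D = record
    { inD  = λ x → inD D (f x)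
    ; down = λ x≤y → down D (f-mono x≤y)
    ; 𝟎∈D  = subst (_∈ D) (sym f-𝟎) (𝟎∈D D)
    ; 𝟏∉D  = subst (λ x → inD D x ≡ false) (sym f-𝟏) (𝟏∉D D)
    }

  κ-≤M-intro : ∀ D E {u v} → (v ∈ E → u ∈ D) → (u ′ ∈ D → v ′ ∈ E) → κ 𝐀 D u ≤M κ 𝐀 E v
  κ-≤M-intro _ _ v∈E⇒u∈D u′∈D⇒v′∈E =
      not-antitone (≤B-intro v∈E⇒u∈D)
    , subst₂ _≤B_ (sym (not-involutive _)) (sym (not-involutive _)) (≤B-intro u′∈D⇒v′∈E)

  κ-≤M-elimˡ : ∀ D E {u v} → κ 𝐀 D u ≤M κ 𝐀 E v → v ∈ E → u ∈ D
  κ-≤M-elimˡ _ _ (h≤h , _) = ≤B-elim (not-reflects h≤h)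

  κ-≤M-elimʳ : ∀ D E {u v} → κ 𝐀 D u ≤M κ 𝐀 E v → u ′ ∈ D → v ′ ∈ E
  κ-≤M-elimʳ _ _ (_ , h∂≤h∂) = ≤B-elim (subst₂ _≤B_ (not-involutive _) (not-involutive _) h∂≤h∂)

  κ-mono : ∀ D {x y} → x ≤ y → κ 𝐀 D x ≤M κ 𝐀 D y
  κ-mono D x≤y = κ-≤M-intro D D (down D x≤y) (down D (′-antitone x≤y))

  κ-′ : ∀ D x → κ 𝐀 D (x ′) ≡ (κ 𝐀 D x) ′M
  κ-′ D x = cong₂ _,_ (sym (not-involutive _)) (cong (λ y → not (not (inD D y))) (′-involutive x))

  κ-𝟎 : ∀ D → κ 𝐀 D 𝟎 ≡ 0M
  κ-𝟎 D rewrite 𝟎∈D D | ′-𝟎 | 𝟏∉D D = refl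

  κ-𝟏 : ∀ D → κ 𝐀 D 𝟏 ≡ 1M
  κ-𝟏 D rewrite 𝟏∉D D | ′-𝟏 | 𝟎∈D D = refl

  module Classical (em : ExcludedMiddle (a ⊔ ℓ)) where
    infix 4 _≤?_
    _≤?_ : ∀ x y → Dec (x ≤ y)
    x ≤? y = map′ lower (lift {ℓ = a}) em

    ≤?-sound : ∀ {x y} → does (x ≤? y) ≡ true → x ≤ y
    ≤?-sound {x} {y} x≤?y with x ≤? y
    ... | yes x≤y = x≤y
    ... | no x≰y = contradiction (trans (sym x≤?y) (dec-false (x ≤? y) x≰y)) λ ()

    ↓ : ∀ y → ¬ (𝟏 ≤ y) → ProperDownSet 𝐀
    ↓ y 𝟏≰y = record
      { inD  = λ x → does (x ≤? y)
      ; down = λ x≤z z≤?y → dec-true (_ ≤? y) (≤-trans x≤z (≤?-sound z≤?y))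
      ; 𝟎∈D  = dec-true (𝟎 ≤? y) (𝟎-least y)
      ; 𝟏∉D  = dec-false (𝟏 ≤? y) 𝟏≰y
      }

    κ-reflects : ∀ {x y} → (∀ D → κ 𝐀 D x ≤M κ 𝐀 D y) → x ≤ y
    κ-reflects {x} {y} κx≤κy with x ≤? y
    ... | yes x≤y = x≤y
    ... | no x≰y = contradiction (≤?-sound (κ-≤M-elimˡ (↓ y 𝟏≰y) (↓ y 𝟏≰y) {x} {y} (κx≤κy (↓ y 𝟏≰y)) y∈↓y)) x≰y
      where
      𝟏≰y : ¬ (𝟏 ≤ y)
      𝟏≰y 𝟏≤y = x≰y (≤-trans (𝟏-greatest x) 𝟏≤y)
      y∈↓y : y ∈ ↓ y 𝟏≰y
      y∈↓y = dec-true (y ≤? y) ≤-refl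

module Canonical {a ℓ} (𝔸 : DynamicDMA a ℓ) where
  open DynamicDMA 𝔸
  open IsPartialOrder isPartialOrder using (antisym) renaming (refl to ≤-refl; trans to ≤-trans)
  open DeMorganPosetProperties poset
  open ProperDownSet

  F-mono : ∀ {x y} → x ≤ y → F x ≤ F y
  F-mono = dual-mono G G-mono

  P-mono : ∀ {x y} → x ≤ y → P x ≤ P y
  P-mono = dual-mono H H-mono

  G≤F : ∀ x → G x ≤ F x
  G≤F x = P4-G ≤-refl

  H≤P : ∀ x → H x ≤ P x
  H≤P x = P4-H ≤-refl

  G-′≤′-G : ∀ x → G (x ′) ≤ G x ′
  G-′≤′-G x = subst (λ y → G (x ′) ≤ G y ′) (′-involutive x) (G≤F (x ′))

  F∘H≤id : ∀ x → F (H x) ≤ x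
  F∘H≤id x = subst (λ y → F (H y) ≤ y) (′-involutive x) (′-antitone (P3-G (x ′)))

  P∘G≤id : ∀ x → P (G x) ≤ x
  P∘G≤id x = subst (λ y → P (G y) ≤ y) (′-involutive x) (′-antitone (P3-H (x ′)))

  H∘G≤id : ∀ x → H (G x) ≤ x
  H∘G≤id x = ≤-trans (H≤P (G x)) (P∘G≤id x)

  ′≤G-H-′ : ∀ x → x ′ ≤ G (H x ′)
  ′≤G-H-′ x = subst (λ y → x ′ ≤ G (H y ′)) (′-involutive x) (P3-G (x ′))

  ′≤H-G-′ : ∀ x → x ′ ≤ H (G x ′)
  ′≤H-G-′ x = subst (λ y → x ′ ≤ H (G y ′)) (′-involutive x) (P3-H (x ′))

  G⁻¹[_] F⁻¹[_] H⁻¹[_] P⁻¹[_] : ProperDownSet poset → ProperDownSet poset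
  G⁻¹[_] = preimage G G-mono G-𝟎 G-𝟏
  F⁻¹[_] = preimage F F-mono (dual-𝟎 G G-𝟏) (dual-𝟏 G G-𝟎)
  H⁻¹[_] = preimage H H-mono H-𝟎 H-𝟏
  P⁻¹[_] = preimage P P-mono (dual-𝟎 H H-𝟏) (dual-𝟏 H H-𝟎)

  infix 4 _⇝_
  _⇝_ : Rel (ProperDownSet poset) a
  D ⇝ E = ∀ x → κ poset D (G x) ≤M κ poset E x

  ⇝-G⁻¹ : ∀ D → D ⇝ G⁻¹[ D ]
  ⇝-G⁻¹ D x = κ-≤M-intro D G⁻¹[ D ] id (down D (G-′≤′-G x))

  ⇝-F⁻¹ : ∀ D → D ⇝ F⁻¹[ D ]
  ⇝-F⁻¹ D x = κ-≤M-intro D F⁻¹[ D ] (down D (G≤F x)) (subst (λ y → G y ′ ∈ D) (sym (′-involutive x)))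

  H⁻¹-⇝ : ∀ D → H⁻¹[ D ] ⇝ D
  H⁻¹-⇝ D x = κ-≤M-intro H⁻¹[ D ] D (down D (H∘G≤id x)) (down D (′≤H-G-′ x))

  P⁻¹-⇝ : ∀ D → P⁻¹[ D ] ⇝ D
  P⁻¹-⇝ D x = κ-≤M-intro P⁻¹[ D ] D (down D (P∘G≤id x))
    (down D (subst (λ y → x ′ ≤ H y ′) (sym (′-involutive (G x))) (′-antitone (H∘G≤id x))))

  ⇝⇒κ-H≤κ : ∀ D E → E ⇝ D → ∀ x → κ poset D (H x) ≤M κ poset E x
  ⇝⇒κ-H≤κ D E E⇝D x = κ-≤M-intro D E
    (λ x∈E → subst (_∈ D) (′-involutive (H x))
                   (κ-≤M-elimʳ E D (E⇝D (H x ′)) (down E (F∘H≤id x) x∈E)))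
    (λ Hx′∈D → down E (′≤G-H-′ x) (κ-≤M-elimˡ E D (E⇝D (H x ′)) Hx′∈D))

  κ-G-split : ∀ D x → κ poset D (G x) ≡ (proj₁ (κ poset G⁻¹[ D ] x) , proj₂ (κ poset F⁻¹[ D ] x))
  κ-G-split D x = cong (λ y → not (inD D (G x)) , not (not (inD D (G y ′)))) (sym (′-involutive x))

  κ-H-split : ∀ D x → κ poset D (H x) ≡ (proj₁ (κ poset H⁻¹[ D ] x) , proj₂ (κ poset P⁻¹[ D ] x))
  κ-H-split D x = cong (λ y → not (inD D (H x)) , not (not (inD D (H y ′)))) (sym (′-involutive x))

  pt : ProperDownSet poset → T 𝔸
  pt D = point (κ poset D) (D , λ _ → refl)

  downset : T 𝔸 → ProperDownSet poset
  downset s = proj₁ (TDMP.isκ s)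

  i≡κ : ∀ x s → i 𝔸 x s ≡ κ poset (downset s) x
  i≡κ x s = proj₂ (TDMP.isκ s) x

  i-≤M-from-κ : ∀ s t {x y} → κ poset (downset s) x ≤M κ poset (downset t) y → i 𝔸 x s ≤M i 𝔸 y t
  i-≤M-from-κ s t = subst₂ _≤M_ (sym (i≡κ _ s)) (sym (i≡κ _ t))

  i-≤M-to-κ : ∀ s t {x y} → i 𝔸 x s ≤M i 𝔸 y t → κ poset (downset s) x ≤M κ poset (downset t) y
  i-≤M-to-κ s t = subst₂ _≤M_ (i≡κ _ s) (i≡κ _ t)

  RG⇒⇝ : ∀ s t → RG 𝔸 s t → downset s ⇝ downset t
  RG⇒⇝ s t sRt x = i-≤M-to-κ s t (sRt x)

  ⇝⇒RG : ∀ s t → downset s ⇝ downset t → RG 𝔸 s t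
  ⇝⇒RG s t s⇝t x = i-≤M-from-κ s t (s⇝t x)

  RG-serial : Serial (RG 𝔸)
  RG-serial s = pt G⁻¹[ downset s ] , ⇝⇒RG s (pt G⁻¹[ downset s ]) (⇝-G⁻¹ (downset s))

  RG⁻¹-serial : Serial (RG⁻¹ 𝔸)
  RG⁻¹-serial s = pt H⁻¹[ downset s ] , ⇝⇒RG (pt H⁻¹[ downset s ]) s (H⁻¹-⇝ (downset s))

  i-Ĝ : ∀ x → IsĜ 𝔸 (i 𝔸 x) (i 𝔸 (G x))
  i-Ĝ x s = coordinatewise-attained⇒IsMeetM₂
    (λ { _ (t , sRt , refl) → sRt x })
    (pt G⁻¹[ D ] , ⇝⇒RG s (pt G⁻¹[ D ]) (⇝-G⁻¹ D) , refl)
    (pt F⁻¹[ D ] , ⇝⇒RG s (pt F⁻¹[ D ]) (⇝-F⁻¹ D) , refl)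
    (trans (i≡κ (G x) s) (κ-G-split D x))
    where D = downset s

  i-Ĥ : ∀ x → IsĤ 𝔸 (i 𝔸 x) (i 𝔸 (H x))
  i-Ĥ x s = coordinatewise-attained⇒IsMeetM₂
    (λ { _ (t , tRs , refl) → i-≤M-from-κ s t (⇝⇒κ-H≤κ (downset s) (downset t) (RG⇒⇝ t s tRs) x) })
    (pt H⁻¹[ D ] , ⇝⇒RG (pt H⁻¹[ D ]) s (H⁻¹-⇝ D) , refl)
    (pt P⁻¹[ D ] , ⇝⇒RG (pt P⁻¹[ D ]) s (P⁻¹-⇝ D) , refl)
    (trans (i≡κ (H x) s) (κ-H-split D x))
    where D = downset s

  i-mono : ∀ {x y} → x ≤ y → _≤ᵀ_ 𝔸 (i 𝔸 x) (i 𝔸 y)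
  i-mono x≤y s = i-≤M-from-κ s s (κ-mono (downset s) x≤y)

  i-′ : ∀ x → _≗ᵀ_ 𝔸 (i 𝔸 (x ′)) (_′ᵀ 𝔸 (i 𝔸 x))
  i-′ x s = begin
    i 𝔸 (x ′) s           ≡⟨ i≡κ (x ′) s ⟩
    κ poset D (x ′)       ≡⟨ κ-′ D x ⟩
    (κ poset D x) ′M      ≡⟨ cong _′M (sym (i≡κ x s)) ⟩
    (i 𝔸 x s) ′M          ∎
    where
    open ≡-Reasoning
    D = downset s

  i-𝟎 : ∀ s → i 𝔸 𝟎 s ≡ 0M
  i-𝟎 s = trans (i≡κ 𝟎 s) (κ-𝟎 (downset s))

  i-𝟏 : ∀ s → i 𝔸 𝟏 s ≡ 1M
  i-𝟏 s = trans (i≡κ 𝟏 s) (κ-𝟏 (downset s))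

  module _ (em : ExcludedMiddle (a ⊔ ℓ)) where
    open Classical em

    T-inhabited : 𝟎 ≢ 𝟏 → T 𝔸
    T-inhabited 𝟎≢𝟏 = pt (↓ 𝟎 λ 𝟏≤𝟎 → 𝟎≢𝟏 (antisym (𝟎-least 𝟏) 𝟏≤𝟎))

    i-reflects : ∀ {x y} → _≤ᵀ_ 𝔸 (i 𝔸 x) (i 𝔸 y) → x ≤ y
    i-reflects ix≤iy = κ-reflects (λ D → ix≤iy (pt D))

    i-isOrderReflectingDMPMorphism : IsOrderReflectingDMPMorphism 𝔸
    i-isOrderReflectingDMPMorphism = i-mono , i-reflects , i-′ , i-𝟎 , i-𝟏

mainTheorem5 : ∀ {a ℓ} → ExcludedMiddle (a ⊔ ℓ) → (𝔸 : DynamicDMA a ℓ)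
    → DynamicDMA.𝟎 𝔸 ≢ DynamicDMA.𝟏 𝔸
    → IsFrame (T 𝔸) (RG 𝔸) × Serial (RG 𝔸) × Serial (RG⁻¹ 𝔸)
      × IsOrderReflectingDMPMorphism 𝔸
      × (∀ x → IsĜ 𝔸 (i 𝔸 x) (i 𝔸 (DynamicDMA.G 𝔸 x)))
      × (∀ x → IsĤ 𝔸 (i 𝔸 x) (i 𝔸 (DynamicDMA.H 𝔸 x)))
mainTheorem5 em 𝔸 𝟎≢𝟏 =
  T-inhabited em 𝟎≢𝟏 , RG-serial , RG⁻¹-serial , i-isOrderReflectingDMPMorphism em , i-Ĝ , i-Ĥ
  where open Canonical 𝔸
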